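{- Let $\mathcal K=(K;\preceq,\cdot,\backslash,/,\wedge,\vee,\top,\bot)$ be an SRBL (resp., $\mathcal K$ an $\omega$PAL with additional operation $^+$), and let $\bot'\in K$ be a local zero of $\mathcal K$. Then the upper cone $K{\uparrow}\bot'=\{a\in K\mid \bot'\preceq a\}$ is closed under all operations of $\mathcal K$ (namely $\cdot,\backslash,/,\wedge,\vee$, and $^+$ in the $\omega$PAL case).
   Context: An SRBL is a structure $(K;\preceq,\cdot,\backslash,/,\wedge,\vee,\top,\bot)$ where $(K;\preceq,\wedge,\vee,\top,\bot)$ is a bounded lattice, $\cdot$ is associative, and $b\preceq a\backslash c\iff a\cdot b\preceq c\iff a\preceq c/b$ for all $a,b,c$. An $\omega$PAL is an SRBL with a unary operation $^+$ satisfying $a^+=\sup_{\preceq}\{a^n\mid n\ge1\}$. An element $\bot'\in K$ is a local zero of $\mathcal K$ if for every $a\in K$ with $\bot'\preceq a$ we have $a\cdot\bot'=\bot'\cdot a=\bot'$. -}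

module Defs where

open import Level using (Level; suc; _⊔_)
open import Data.Nat using (ℕ; zero) renaming (suc to sucℕ)
open import Data.Product using (_×_)
open import Relation.Binary.PropositionalEquality using (_≡_)

record SRBL (c ℓ : Level) : Set (suc (c ⊔ ℓ)) where
  infix  4 _≼_
  infixl 7 _·_
  field
    K     : Set c
    _≼_   : K → K → Set ℓ
    _·_   : K → K → K
    _\\_  : K → K → K
    _//_  : K → K → K
    _∧_   : K → K → K
    _∨_   : K → K → K
    ⊤     : K
    ⊥     : K
    ≼-refl    : ∀ {a} → a ≼ a
    ≼-trans   : ∀ {a b c} → a ≼ b → b ≼ c → a ≼ c
    ≼-antisym : ∀ {a b} → a ≼ b → b ≼ a → a ≡ b
    ∧-lb₁ : ∀ a b → (a ∧ b) ≼ a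
    ∧-lb₂ : ∀ a b → (a ∧ b) ≼ b
    ∧-glb : ∀ {a b c} → c ≼ a → c ≼ b → c ≼ (a ∧ b)
    ∨-ub₁ : ∀ a b → a ≼ (a ∨ b)
    ∨-ub₂ : ∀ a b → b ≼ (a ∨ b)
    ∨-lub : ∀ {a b c} → a ≼ c → b ≼ c → (a ∨ b) ≼ c
    ⊤-max : ∀ a → a ≼ ⊤
    ⊥-min : ∀ a → ⊥ ≼ a
    ·-assoc : ∀ a b c → (a · b) · c ≡ a · (b · c)
    resˡ₁ : ∀ {a b c} → b ≼ (a \\ c) → a · b ≼ c
    resˡ₂ : ∀ {a b c} → a · b ≼ c → b ≼ (a \\ c)
    resʳ₁ : ∀ {a b c} → a ≼ (c // b) → a · b ≼ c
    resʳ₂ : ∀ {a b c} → a · b ≼ c → a ≼ (c // b)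

  -- pow a n = a^(n+1), i.e. the positive powers a, a·a, a·a·a, ...
  pow : K → ℕ → K
  pow a zero     = a
  pow a (sucℕ n) = a · pow a n

  IsLocalZero : K → Set (c ⊔ ℓ)
  IsLocalZero z = ∀ a → z ≼ a → (a · z ≡ z) × (z · a ≡ z)

  _∈↑_ : K → K → Set ℓ
  a ∈↑ z = z ≼ a

record ωPAL (c ℓ : Level) : Set (suc (c ⊔ ℓ)) where
  field
    srbl : SRBL c ℓ
  open SRBL srbl
  field
    _⁺     : K → K
    ⁺-ub   : ∀ a n → pow a n ≼ (a ⁺)
    ⁺-lub  : ∀ a b → (∀ n → pow a n ≼ b) → (a ⁺) ≼ b

{-# OPTIONS --safe #-}
module Submission where

open import Defs
open import Level using (Level)
open import Data.Product using (_×_; _,_; proj₁; proj₂)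
open import Relation.Binary.PropositionalEquality using (subst; sym)

-- A local zero z is absorbed by every a ∈↑ z.  Hence z = a · z ≼ a · b by
-- monotonicity of ·, and by residuation z ≼ a \\ b and z ≼ b // a reduce to
-- z ≼ b once a · z, resp. z · a, is rewritten to z.  The lattice operations
-- and ⁺ need no absorption: z ≼ a ≼ a ∨ b and a ≼ a⁺.

module UpperCone {c ℓ : Level} (𝒦 : SRBL c ℓ) where
  open SRBL 𝒦

  ·-monoʳ-≼ : ∀ {a b b′} → b ≼ b′ → a · b ≼ a · b′
  ·-monoʳ-≼ b≼b′ = resˡ₁ (≼-trans b≼b′ (resˡ₂ ≼-refl))

  module _ {z : K} (z-zero : IsLocalZero z) {a b : K} (a∈↑z : a ∈↑ z) where

    ∈↑-· : b ∈↑ z → (a · b) ∈↑ z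
    ∈↑-· b∈↑z = subst (_≼ a · b) (proj₁ (z-zero a a∈↑z)) (·-monoʳ-≼ b∈↑z)

    ∈↑-\\ : b ∈↑ z → (a \\ b) ∈↑ z
    ∈↑-\\ b∈↑z = resˡ₂ (subst (_≼ b) (sym (proj₁ (z-zero a a∈↑z))) b∈↑z)

    ∈↑-// : b ∈↑ z → (b // a) ∈↑ z
    ∈↑-// b∈↑z = resʳ₂ (subst (_≼ b) (sym (proj₂ (z-zero a a∈↑z))) b∈↑z)

  module _ {z a b : K} (a∈↑z : a ∈↑ z) where

    ∈↑-∧ : b ∈↑ z → (a ∧ b) ∈↑ z
    ∈↑-∧ b∈↑z = ∧-glb a∈↑z b∈↑z

    ∈↑-∨ : (a ∨ b) ∈↑ z
    ∈↑-∨ = ≼-trans a∈↑z (∨-ub₁ a b)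

  closed : ∀ (z : K) → IsLocalZero z → ∀ (a b : K) → a ∈↑ z → b ∈↑ z →
    ((a · b) ∈↑ z) × ((a \\ b) ∈↑ z) × ((a // b) ∈↑ z)
      × ((a ∧ b) ∈↑ z) × ((a ∨ b) ∈↑ z)
  closed z z-zero a b a∈↑z b∈↑z =
      ∈↑-· z-zero a∈↑z b∈↑z
    , ∈↑-\\ z-zero a∈↑z b∈↑z
    , ∈↑-// z-zero b∈↑z a∈↑z
    , ∈↑-∧ a∈↑z b∈↑z
    , ∈↑-∨ a∈↑z

module _ {c ℓ : Level} (𝒫 : ωPAL c ℓ) where
  open ωPAL 𝒫
  open SRBL srbl

  ∈↑-⁺ : ∀ {z a} → a ∈↑ z → (a ⁺) ∈↑ z
  ∈↑-⁺ {a = a} a∈↑z = ≼-trans a∈↑z (⁺-ub a 0)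

lemma2 : ∀ {c ℓ : Level} →
    ((𝒦 : SRBL c ℓ) → let open SRBL 𝒦 in
      ∀ (z : K) → IsLocalZero z → ∀ (a b : K) → a ∈↑ z → b ∈↑ z →
        ((a · b) ∈↑ z) × ((a \\ b) ∈↑ z) × ((a // b) ∈↑ z)
          × ((a ∧ b) ∈↑ z) × ((a ∨ b) ∈↑ z))
    × ((𝒫 : ωPAL c ℓ) → let open ωPAL 𝒫 in let open SRBL srbl in
      ∀ (z : K) → IsLocalZero z → ∀ (a b : K) → a ∈↑ z → b ∈↑ z →
        ((a · b) ∈↑ z) × ((a \\ b) ∈↑ z) × ((a // b) ∈↑ z)
          × ((a ∧ b) ∈↑ z) × ((a ∨ b) ∈↑ z) × ((a ⁺) ∈↑ z))
lemma2 = UpperCone.closed , λ 𝒫 z z-zero a b a∈↑z b∈↑z →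
  let (ab , a\\b , a//b , a∧b , a∨b) =
        UpperCone.closed (ωPAL.srbl 𝒫) z z-zero a b a∈↑z b∈↑z
  in ab , a\\b , a//b , a∧b , a∨b , ∈↑-⁺ 𝒫 a∈↑z
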